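{- For every integer $n\ge 3$, the strong hub cover pebbling number of the path $P_n$ on $n$ vertices satisfies $h_s^*(P_n)=2^{n-1}-1$.
   Context: All graphs are finite, simple and connected. A configuration of pebbles on a graph $G=(V,E)$ is a function assigning a nonnegative integer number of pebbles to each vertex. A pebbling move consists of choosing adjacent vertices $u,v$ where $u$ has at least two pebbles, removing two pebbles from $u$ and adding one pebble to $v$. A nonempty set $U\subseteq V$ is a strong hub set if for any two vertices of $G$ there is a path between them all of whose internal vertices lie in $U$ (a path with no internal vertices, i.e. an edge, qualifies). The strong hub cover pebbling number $h_s^*(G)$ is the smallest integer $t$ such that for every configuration with $t$ pebbles on $G$, one can perform a sequence of pebbling moves after which there is a strong hub set $U$ with every vertex of $U$ having at least one pebble. $P_n$ denotes the path with vertices $v_1,\dots,v_n$ in order. -}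

module Defs where

open import Data.Nat using (ℕ; zero; suc; _+_; _∸_; _≤_; _<_)
open import Data.Fin using (Fin; toℕ; _≟_)
import Data.Fin as F
open import Data.Fin.Subset using (Subset; _∈_; Nonempty)
open import Data.Bool using (if_then_else_)
open import Data.List using (List; []; _∷_; _++_)
open import Data.List.Relation.Unary.All using (All)
open import Data.List.Relation.Unary.Linked using (Linked)
open import Data.List.Relation.Unary.Unique.Propositional using (Unique)
open import Data.Product using (Σ; ∃; _×_; _,_)
open import Data.Sum using (_⊎_)
open import Relation.Nullary using (¬_; does)
open import Relation.Binary.PropositionalEquality using (_≡_)
open import Relation.Binary.Construct.Closure.ReflexiveTransitive using (Star)

Graph : ℕ → Set₁
Graph n = Fin n → Fin n → Set

-- The path P_n : vertices 0,…,n-1 (v_1,…,v_n), i adjacent to j iff |i - j| = 1.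
PathGraph : (n : ℕ) → Graph n
PathGraph n i j = (suc (toℕ i) ≡ toℕ j) ⊎ (suc (toℕ j) ≡ toℕ i)

Config : ℕ → Set
Config n = Fin n → ℕ

total : ∀ {n} → Config n → ℕ
total {zero} c = 0
total {suc n} c = c F.zero + total (λ i → c (F.suc i))

move : ∀ {n} → Fin n → Fin n → Config n → Config n
move u v c w =
  (if does (w ≟ u) then c w ∸ 2 else c w) + (if does (w ≟ v) then 1 else 0)

data Step {n} (G : Graph n) (c : Config n) : Config n → Set where
  step : (u v : Fin n) → G u v → 2 ≤ c u → Step G c (move u v c)

Reach : ∀ {n} → Graph n → Config n → Config n → Set
Reach G = Star (Step G)

HubPath : ∀ {n} → Graph n → Subset n → Fin n → Fin n → Set
HubPath {n} G U x y =
  Σ (List (Fin n)) λ is →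
    Linked G (x ∷ is ++ y ∷ []) × Unique (x ∷ is ++ y ∷ []) × All (_∈ U) is

StrongHubSet : ∀ {n} → Graph n → Subset n → Set
StrongHubSet {n} G U = Nonempty U × ((x y : Fin n) → ¬ (x ≡ y) → HubPath G U x y)

Covers : ∀ {n} → Config n → Subset n → Set
Covers {n} c U = (v : Fin n) → v ∈ U → 1 ≤ c v

Solvable : ∀ {n} → Graph n → Config n → Set
Solvable {n} G c =
  Σ (Config n) λ c' → Reach G c c' × Σ (Subset n) λ U → StrongHubSet G U × Covers c' U

AllSolvable : ∀ {n} → Graph n → ℕ → Set
AllSolvable {n} G t = (c : Config n) → total c ≡ t → Solvable G c

IsStrongHubCoverPebblingNumber : ∀ {n} → Graph n → ℕ → Set
IsStrongHubCoverPebblingNumber G t =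
  AllSolvable G t × ((s : ℕ) → s < t → ¬ AllSolvable G s)

-- The only path from v_1 to v_n passes through every interior
-- vertex v_2, …, v_(n-1), so the strong hub sets of P_n are the sets containing the interior,
-- and a configuration is solvable iff it can reach one in which the whole interior is occupied.
--
-- Lower bound: the weight Σ 2^(i-1) c(v_i), in which the first pebble on v_n is not counted,
-- never increases under a move, and it is at least 2^(n-1) - 2 once the interior is occupied.
-- Putting s - 1 pebbles on v_1 and one on v_n gives weight s - 1.
--
-- Upper bound: sweep from v_1 to v_n. If v_1 holds at most one pebble, the other vertices
-- have to deliver one pebble to v_2 and occupy the rest of the interior. Otherwise half of
-- v_1 is pushed to v_2, one pebble stays there and the sweep goes on. To deliver k pebbles
-- to the first vertex, either keep k of the pebbles already there and sweep the surplus, or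
-- ask the second vertex for 2d + 1 pebbles, where d is the shortfall.
module Submission where

open import Defs
open import Level using (0ℓ)
open import Function using (_∘_; flip)
open import Data.Nat using (ℕ; zero; suc; _+_; _*_; _∸_; _^_; _≤_; _<_; z≤n; s≤s; z<s)
open import Data.Nat.Properties
open import Data.Nat.DivMod using (_/_; _%_; m≡m%n+[m/n]*n; m%n<n; m/n*n≤m)
open import Data.Nat.Tactic.RingSolver using (solve-∀)
open import Data.Fin using (Fin; zero; suc; toℕ; fromℕ; fromℕ<)
import Data.Fin.Properties as F
open import Data.Fin.Subset using (Subset; _∈_; _⊆_; inside; outside)
open import Data.Vec as Vec using (Vec; []; _∷_; lookup; sum; head; tabulate)
open import Data.Vec.Properties using (lookup∘tabulate)
open import Data.List using ([]; _∷_; _++_; [_])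
open import Data.List.Relation.Unary.All as All using (All; []; _∷_)
open import Data.List.Relation.Unary.Any as Any using (Any)
open import Data.List.Relation.Unary.Linked as Linked using (Linked; [-]; _∷_)
open import Data.List.Relation.Unary.Linked.Properties using (Linked⇒AllPairs)
import Data.List.Relation.Unary.AllPairs as AllPairs
open import Data.List.Relation.Unary.Unique.Propositional using (Unique)
open import Data.Product using (∃-syntax; ∃₂; _×_; _,_)
import Data.Product as Product
open import Data.Sum using (_⊎_; inj₁; inj₂)
import Data.Sum as Sum
open import Data.Unit using (⊤; tt)
open import Data.Empty using (⊥-elim)
open import Relation.Nullary using (¬_; yes; no)
open import Relation.Binary using (Rel; Transitive; Irreflexive; tri<; tri≈; tri>)
open import Relation.Binary.PropositionalEquality hiding ([_])
open import Relation.Binary.Construct.Closure.ReflexiveTransitive using (Star; ε; _◅_; _◅◅_; gmap)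

infix 4 _⇝_ _⇝*_

data _⇝_ : ∀ {m} → Vec ℕ m → Vec ℕ m → Set where
  right : ∀ {m a b} {xs : Vec ℕ m} → (suc (suc a) ∷ b ∷ xs) ⇝ (a ∷ suc b ∷ xs)
  left  : ∀ {m a b} {xs : Vec ℕ m} → (a ∷ suc (suc b) ∷ xs) ⇝ (suc a ∷ b ∷ xs)
  there : ∀ {m x} {xs ys : Vec ℕ (suc m)} → xs ⇝ ys → (x ∷ xs) ⇝ (x ∷ ys)

_⇝*_ : ∀ {m} → Vec ℕ m → Vec ℕ m → Set
_⇝*_ = Star _⇝_

Reachable : ∀ {m} → (Vec ℕ m → Set) → Vec ℕ m → Set
Reachable P v = ∃[ w ] v ⇝* w × P w

there* : ∀ {m x} {xs ys : Vec ℕ (suc m)} → xs ⇝* ys → (x ∷ xs) ⇝* (x ∷ ys)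
there* = gmap (_ ∷_) there

sucHead : ∀ {m} → Vec ℕ (suc m) → Vec ℕ (suc m)
sucHead (x ∷ xs) = suc x ∷ xs

⇝-sucHead : ∀ {m} {v w : Vec ℕ (suc m)} → v ⇝ w → sucHead v ⇝ sucHead w
⇝-sucHead right     = right
⇝-sucHead left      = left
⇝-sucHead (there s) = there s

⇝*-+head : ∀ d {m x y} {xs ys : Vec ℕ m} →
           (x ∷ xs) ⇝* (y ∷ ys) → (d + x ∷ xs) ⇝* (d + y ∷ ys)
⇝*-+head zero    r = r
⇝*-+head (suc d) r = gmap sucHead ⇝-sucHead (⇝*-+head d r)

pushʳ : ∀ j {m a b} {xs : Vec ℕ m} → j * 2 ≤ a →
        (a ∷ b ∷ xs) ⇝* (a ∸ j * 2 ∷ j + b ∷ xs)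
pushʳ zero    _ = ε
pushʳ (suc j) {a = suc (suc a)} {b} {xs} (s≤s (s≤s h)) =
  right ◅ subst (λ y → (a ∷ suc b ∷ xs) ⇝* (a ∸ j * 2 ∷ y ∷ xs)) (+-suc j b) (pushʳ j h)

pushˡ : ∀ j {m a b} {xs : Vec ℕ m} → j * 2 ≤ b →
        (a ∷ b ∷ xs) ⇝* (j + a ∷ b ∸ j * 2 ∷ xs)
pushˡ zero    _ = ε
pushˡ (suc j) {a = a} {suc (suc b)} {xs} (s≤s (s≤s h)) =
  left ◅ subst (λ y → (suc a ∷ b ∷ xs) ⇝* (y ∷ b ∸ j * 2 ∷ xs)) (+-suc j a) (pushˡ j h)

-- Pebbling on the path P_n is pebbling on vectors

move-right : ∀ {m a b} {xs : Vec ℕ m} →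
             move zero (suc zero) (lookup (suc (suc a) ∷ b ∷ xs)) ≗ lookup (a ∷ suc b ∷ xs)
move-right {a = a} zero          = +-identityʳ a
move-right {b = b} (suc zero)    = +-comm b 1
move-right         (suc (suc i)) = +-identityʳ _

move-left : ∀ {m a b} {xs : Vec ℕ m} →
            move (suc zero) zero (lookup (a ∷ suc (suc b) ∷ xs)) ≗ lookup (suc a ∷ b ∷ xs)
move-left {a = a} zero          = +-comm a 1
move-left {b = b} (suc zero)    = +-identityʳ b
move-left         (suc (suc i)) = +-identityʳ _

move-there : ∀ {m x} {u u' : Fin m} {xs ys : Vec ℕ m} → move u u' (lookup xs) ≗ lookup ys →
             move (suc u) (suc u') (lookup (x ∷ xs)) ≗ lookup (x ∷ ys)
move-there {x = x} _ zero    = +-identityʳ x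
move-there         e (suc i) = e i

move-cong : ∀ {n} (u u' : Fin n) {c d : Config n} → c ≗ d → move u u' c ≗ move u u' d
move-cong u u' c≗d i rewrite c≗d i = refl

⇝⇒step : ∀ {n} {v w : Vec ℕ n} → v ⇝ w →
         ∃₂ λ u u' → PathGraph n u u' × 2 ≤ lookup v u × move u u' (lookup v) ≗ lookup w
⇝⇒step right     = zero , suc zero , inj₁ refl , s≤s (s≤s z≤n) , move-right
⇝⇒step left      = suc zero , zero , inj₂ refl , s≤s (s≤s z≤n) , move-left
⇝⇒step (there s) with u , u' , adj , h , e ← ⇝⇒step s =
  suc u , suc u' , Sum.map (cong suc) (cong suc) adj , h , move-there e

step⇒⇝ : ∀ {n} {u u' : Fin n} (v : Vec ℕ n) → PathGraph n u u' → 2 ≤ lookup v u →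
         ∃[ w ] v ⇝ w × move u u' (lookup v) ≗ lookup w
step⇒⇝ {u = zero}        {zero}        _ (inj₁ ()) _
step⇒⇝ {u = zero}        {zero}        _ (inj₂ ()) _
step⇒⇝ {u = zero}        {suc (suc _)} _ (inj₁ ()) _
step⇒⇝ {u = zero}        {suc (suc _)} _ (inj₂ ()) _
step⇒⇝ {u = suc (suc _)} {zero}        _ (inj₁ ()) _
step⇒⇝ {u = suc (suc _)} {zero}        _ (inj₂ ()) _
step⇒⇝ {u = zero}     {suc zero} (suc (suc a) ∷ b ∷ xs) _ (s≤s (s≤s _)) =
  a ∷ suc b ∷ xs , right , move-right
step⇒⇝ {u = suc zero} {zero}     (a ∷ suc (suc b) ∷ xs) _ (s≤s (s≤s _)) =
  suc a ∷ b ∷ xs , left , move-left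
step⇒⇝ {u = suc u}    {suc u'}   (x ∷ xs@(_ ∷ _)) adj h
  with w , s , e ← step⇒⇝ xs (Sum.map suc-injective suc-injective adj) h =
  x ∷ w , there s , move-there e

⇝*⇒reach : ∀ {n} {v w : Vec ℕ n} {c : Config n} → v ⇝* w → c ≗ lookup v →
           ∃[ c' ] Reach (PathGraph n) c c' × c' ≗ lookup w
⇝*⇒reach ε        c≗v = _ , ε , c≗v
⇝*⇒reach (s ◅ ss) c≗v with u , u' , adj , h , e ← ⇝⇒step s
  with c' , r , c'≗w ← ⇝*⇒reach ss (λ i → trans (move-cong u u' c≗v i) (e i)) =
  c' , step u u' adj (subst (2 ≤_) (sym (c≗v u)) h) ◅ r , c'≗w

reach⇒⇝* : ∀ {n} {c c' : Config n} {v : Vec ℕ n} → Reach (PathGraph n) c c' → c ≗ lookup v →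
           ∃[ w ] v ⇝* w × c' ≗ lookup w
reach⇒⇝*         ε                     c≗v = _ , ε , c≗v
reach⇒⇝* {v = v} (step u u' adj h ◅ r) c≗v
  with w , s , e ← step⇒⇝ v adj (subst (2 ≤_) (c≗v u) h)
  with w' , ss , c'≗w' ← reach⇒⇝* r (λ i → trans (move-cong u u' c≗v i) (e i)) =
  w' , s ◅ ss , c'≗w'

total≡sum : ∀ {n} {c : Config n} {v : Vec ℕ n} → c ≗ lookup v → total c ≡ sum v
total≡sum {v = []}     _   = refl
total≡sum {v = _ ∷ xs} c≗v = cong₂ _+_ (c≗v zero) (total≡sum {v = xs} (c≗v ∘ suc))

-- Strong hub sets of P_n

allButLast : ∀ m → Subset (suc m)
allButLast zero    = outside ∷ []
allButLast (suc m) = inside ∷ allButLast m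

interior : ∀ m → Subset (suc (suc m))
interior m = outside ∷ allButLast m

∈-allButLast⁺ : ∀ {m} {i : Fin (suc m)} → toℕ i < m → i ∈ allButLast m
∈-allButLast⁺ {suc m} {zero}  _         = Vec.here
∈-allButLast⁺ {suc m} {suc i} (s≤s i<m) = Vec.there (∈-allButLast⁺ i<m)

∈-allButLast⁻ : ∀ {m} {i : Fin (suc m)} → i ∈ allButLast m → toℕ i < m
∈-allButLast⁻ {zero}  {zero}  ()
∈-allButLast⁻ {suc m} {zero}  _              = s≤s z≤n
∈-allButLast⁻ {suc m} {suc i} (Vec.there i∈) = s≤s (∈-allButLast⁻ i∈)

∈-interior⁺ : ∀ {m} {i : Fin (suc (suc m))} → 0 < toℕ i → toℕ i < suc m → i ∈ interior m
∈-interior⁺ {i = suc i} _ (s≤s i<m) = Vec.there (∈-allButLast⁺ i<m)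

∈-interior⁻ : ∀ {m} {i : Fin (suc (suc m))} → i ∈ interior m → 0 < toℕ i × toℕ i < suc m
∈-interior⁻ {i = suc i} (Vec.there i∈) = s≤s z≤n , s≤s (∈-allButLast⁻ i∈)

module _ {A : Set} {_≺_ : Rel A 0ℓ} (≺-trans : Transitive _≺_) where

  chain⇒ends : ∀ {x y} is → Linked _≺_ (x ∷ is ++ [ y ]) → x ≺ y
  chain⇒ends []       (x≺y ∷ [-])  = x≺y
  chain⇒ends (z ∷ is) (x≺z ∷ walk) = ≺-trans x≺z (chain⇒ends is walk)

  chain⇒between : ∀ {x y} is → Linked _≺_ (x ∷ is ++ [ y ]) → All (λ z → x ≺ z × z ≺ y) is
  chain⇒between []       _            = []
  chain⇒between (z ∷ is) (x≺z ∷ walk) =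
    (x≺z , chain⇒ends is walk) ∷ All.map (Product.map₁ (≺-trans x≺z)) (chain⇒between is walk)

  chain⇒unique : Irreflexive _≡_ _≺_ → ∀ {xs} → Linked _≺_ xs → Unique xs
  chain⇒unique irrefl = AllPairs.map (λ x≺y x≡y → irrefl x≡y x≺y) ∘ Linked⇒AllPairs ≺-trans

Succ : ∀ {n} → Rel (Fin n) 0ℓ
Succ a b = suc (toℕ a) ≡ toℕ b

ascent : ∀ {n} d (x y : Fin n) → suc (toℕ x + d) ≡ toℕ y → ∃[ is ] Linked Succ (x ∷ is ++ [ y ])
ascent zero    x y eq = [] , trans (cong suc (sym (+-identityʳ _))) eq ∷ [-]
ascent (suc d) x y eq = let is , walk = ascent d x' y eq' in x' ∷ is , sym x'≡x+1 ∷ walk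
  where
  x+1<n : suc (toℕ x) < _
  x+1<n = <-trans (subst (suc (toℕ x) <_) eq (s≤s (m<m+n (toℕ x) z<s))) (F.toℕ<n y)
  x' = fromℕ< x+1<n
  x'≡x+1 : toℕ x' ≡ suc (toℕ x)
  x'≡x+1 = F.toℕ-fromℕ< x+1<n
  eq' : suc (toℕ x' + d) ≡ toℕ y
  eq' = trans (cong (λ k → suc (k + d)) x'≡x+1) (trans (cong suc (sym (+-suc (toℕ x) d))) eq)

descent : ∀ {n} d (x y : Fin n) → suc (toℕ y + d) ≡ toℕ x →
          ∃[ is ] Linked (flip Succ) (x ∷ is ++ [ y ])
descent zero    x y eq = [] , trans (cong suc (sym (+-identityʳ _))) eq ∷ [-]
descent (suc d) x y eq =
  let is , walk = descent d x' y (sym x'≡y+d+1) in x' ∷ is , trans (cong suc x'≡y+d+1) eq' ∷ walk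
  where
  eq' : suc (suc (toℕ y + d)) ≡ toℕ x
  eq' = trans (cong suc (sym (+-suc (toℕ y) d))) eq
  y+d+1<n : suc (toℕ y + d) < _
  y+d+1<n = <-trans (≤-reflexive eq') (F.toℕ<n x)
  x' = fromℕ< y+d+1<n
  x'≡y+d+1 : toℕ x' ≡ suc (toℕ y + d)
  x'≡y+d+1 = F.toℕ-fromℕ< y+d+1<n

interior-strongHub : ∀ m → 1 ≤ m → StrongHubSet (PathGraph (2 + m)) (interior m)
interior-strongHub m@(suc _) _ = (suc zero , Vec.there Vec.here) , hubPath
  where
  between∈interior : ∀ {x y z : Fin (2 + m)} → toℕ x < toℕ z → toℕ z < toℕ y → z ∈ interior m
  between∈interior {y = y} x<z z<y =
    ∈-interior⁺ (≤-trans (s≤s z≤n) x<z) (<-≤-trans z<y (≤-pred (F.toℕ<n y)))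

  hubPath : ∀ x y → x ≢ y → HubPath (PathGraph (2 + m)) (interior m) x y
  hubPath x y x≢y with <-cmp (toℕ x) (toℕ y)
  ... | tri≈ _ x≡y _ = ⊥-elim (x≢y (F.toℕ-injective x≡y))
  ... | tri< x<y _ _ =
    let d , eq = m≤n⇒∃[o]m+o≡n x<y ; is , walk = ascent d x y eq
        chain = Linked.map ≤-reflexive walk in
    is , Linked.map inj₁ walk , chain⇒unique F.<-trans F.<-irrefl chain ,
    All.map (Product.uncurry between∈interior) (chain⇒between F.<-trans is chain)
  ... | tri> _ _ y<x =
    let d , eq = m≤n⇒∃[o]m+o≡n y<x ; is , walk = descent d x y eq
        chain = Linked.map ≤-reflexive walk in
    is , Linked.map inj₂ walk , chain⇒unique (flip F.<-trans) (F.<-irrefl ∘ sym) chain ,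
    All.map (λ (x>z , z>y) → between∈interior z>y x>z) (chain⇒between (flip F.<-trans) is chain)

adjacent-≤ : ∀ {n t} {a b : Fin n} → PathGraph n a b → toℕ a < t → toℕ b ≤ t
adjacent-≤ (inj₁ a+1≡b) a<t = subst (_≤ _) a+1≡b a<t
adjacent-≤ (inj₂ b+1≡a) a<t = <⇒≤ (<-trans (≤-reflexive b+1≡a) a<t)

passesThrough : ∀ {n t} {x y : Fin n} is → Linked (PathGraph n) (x ∷ is ++ [ y ]) →
                toℕ x < t → t < toℕ y → Any (λ z → toℕ z ≡ t) is
passesThrough         []       (xy ∷ [-])   x<t t<y = ⊥-elim (<⇒≱ t<y (adjacent-≤ xy x<t))
passesThrough {t = t} (z ∷ is) (xz ∷ walk) x<t t<y with toℕ z ≟ t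
... | yes z≡t = Any.here z≡t
... | no  z≢t = Any.there (passesThrough is walk (≤∧≢⇒< (adjacent-≤ xz x<t) z≢t) t<y)

strongHub⇒interior⊆ : ∀ {m} {U : Subset (2 + m)} →
                      StrongHubSet (PathGraph (2 + m)) U → interior m ⊆ U
strongHub⇒interior⊆ {m} {U} (_ , hubPath) {i} i∈ =
  let is , walk , _ , is⊆U = hubPath zero (fromℕ (suc m)) (λ ())
      0<i , i<m+1 = ∈-interior⁻ i∈
      z∈U , z≡i = All.lookupAny is⊆U
                    (passesThrough is walk 0<i (subst (toℕ i <_) (sym (F.toℕ-fromℕ (suc m))) i<m+1))
  in subst (_∈ U) (F.toℕ-injective z≡i) z∈U

-- Solvability on P_n as reachability of vectors

OccupiedButLast : ∀ {m} → Vec ℕ (suc m) → Set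
OccupiedButLast (x ∷ [])     = ⊤
OccupiedButLast (x ∷ y ∷ ys) = 1 ≤ x × OccupiedButLast (y ∷ ys)

InteriorOccupied : ∀ {m} → Vec ℕ (2 + m) → Set
InteriorOccupied (_ ∷ ws) = OccupiedButLast ws

occupied-∷ : ∀ {m x} (ws : Vec ℕ (suc m)) → 1 ≤ x → OccupiedButLast ws → OccupiedButLast (x ∷ ws)
occupied-∷ (_ ∷ _) = _,_

occupied⇒covers : ∀ {m} (ws : Vec ℕ (suc m)) →
                  OccupiedButLast ws → Covers (lookup ws) (allButLast m)
occupied⇒covers (x ∷ [])     _         zero    ()
occupied⇒covers (x ∷ y ∷ ys) (1≤x , _) zero    _              = 1≤x
occupied⇒covers (x ∷ y ∷ ys) (_ , occ) (suc i) (Vec.there i∈) =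
  occupied⇒covers (y ∷ ys) occ i i∈

covers⇒occupied : ∀ {m} (ws : Vec ℕ (suc m)) →
                  Covers (lookup ws) (allButLast m) → OccupiedButLast ws
covers⇒occupied (x ∷ [])     _   = tt
covers⇒occupied (x ∷ y ∷ ys) cov =
  cov zero Vec.here , covers⇒occupied (y ∷ ys) (λ i i∈ → cov (suc i) (Vec.there i∈))

interiorOccupied⇒covers : ∀ {m} {c : Config (2 + m)} (w : Vec ℕ (2 + m)) → c ≗ lookup w →
                          InteriorOccupied w → Covers c (interior m)
interiorOccupied⇒covers (_ ∷ ws) c≗w occ (suc i) (Vec.there i∈) =
  subst (1 ≤_) (sym (c≗w (suc i))) (occupied⇒covers ws occ i i∈)

covers⇒interiorOccupied : ∀ {m} {c : Config (2 + m)} (w : Vec ℕ (2 + m)) → c ≗ lookup w →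
                          Covers c (interior m) → InteriorOccupied w
covers⇒interiorOccupied (_ ∷ ws) c≗w cov =
  covers⇒occupied ws (λ i i∈ → subst (1 ≤_) (c≗w (suc i)) (cov (suc i) (Vec.there i∈)))

reachable⇒solvable : ∀ {m c} {v : Vec ℕ (2 + m)} → 1 ≤ m → c ≗ lookup v →
                     Reachable InteriorOccupied v → Solvable (PathGraph (2 + m)) c
reachable⇒solvable {m} 1≤m c≗v (w , v⇝*w , occ) =
  let c' , reach , c'≗w = ⇝*⇒reach v⇝*w c≗v in
  c' , reach , interior m , interior-strongHub m 1≤m , interiorOccupied⇒covers w c'≗w occ

solvable⇒reachable : ∀ {m c} {v : Vec ℕ (2 + m)} → c ≗ lookup v →
                     Solvable (PathGraph (2 + m)) c → Reachable InteriorOccupied v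
solvable⇒reachable c≗v (c' , reach , U , hub , cov) =
  let w , v⇝*w , c'≗w = reach⇒⇝* reach c≗v in
  w , v⇝*w , covers⇒interiorOccupied w c'≗w (λ i → cov i ∘ strongHub⇒interior⊆ hub)

2≤2^suc : ∀ m → 2 ≤ 2 ^ suc m
2≤2^suc m = *-monoʳ-≤ 2 (m^n>0 2 m)

-- Lower bound

-- Horner form of Σ 2^i x_i, except that the first pebble on the last vertex counts for nothing.
weight : ∀ {m} → Vec ℕ (suc m) → ℕ
weight (x ∷ [])     = x ∸ 1
weight (x ∷ y ∷ ys) = x + 2 * weight (y ∷ ys)

weight-∷ : ∀ {m} x (xs : Vec ℕ (suc m)) → weight (x ∷ xs) ≡ x + 2 * weight xs
weight-∷ x (_ ∷ _) = refl

weight-suc : ∀ {m x} (xs : Vec ℕ m) → weight (suc x ∷ xs) ≤ suc (weight (x ∷ xs))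
weight-suc {x = x} [] = m≤n+m∸n x 1
weight-suc (_ ∷ _)    = ≤-refl

weight-suc-suc : ∀ {m x} (xs : Vec ℕ m) → suc (weight (x ∷ xs)) ≤ weight (suc (suc x) ∷ xs)
weight-suc-suc {x = x} [] = s≤s (m∸n≤m x 1)
weight-suc-suc (_ ∷ _)    = n≤1+n _

+-2*-suc : ∀ a w → a + 2 * suc w ≡ 2 + (a + 2 * w)
+-2*-suc = solve-∀

⇝-weight : ∀ {m} {v w : Vec ℕ (suc m)} → v ⇝ w → weight w ≤ weight v
⇝-weight (right {a = a} {b} {xs}) = begin
  a + 2 * weight (suc b ∷ xs)    ≤⟨ +-monoʳ-≤ a (*-monoʳ-≤ 2 (weight-suc xs)) ⟩
  a + 2 * suc (weight (b ∷ xs))  ≡⟨ +-2*-suc a (weight (b ∷ xs)) ⟩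
  2 + (a + 2 * weight (b ∷ xs))  ∎
  where open ≤-Reasoning
⇝-weight (left {a = a} {b} {xs}) = begin
  1 + (a + 2 * weight (b ∷ xs))      ≤⟨ n≤1+n _ ⟩
  2 + (a + 2 * weight (b ∷ xs))      ≡⟨ +-2*-suc a (weight (b ∷ xs)) ⟨
  a + 2 * suc (weight (b ∷ xs))      ≤⟨ +-monoʳ-≤ a (*-monoʳ-≤ 2 (weight-suc-suc xs)) ⟩
  a + 2 * weight (suc (suc b) ∷ xs)  ∎
  where open ≤-Reasoning
⇝-weight (there {x = x} {_ ∷ _} {_ ∷ _} s) = +-monoʳ-≤ x (*-monoʳ-≤ 2 (⇝-weight s))

⇝*-weight : ∀ {m} {v w : Vec ℕ (suc m)} → v ⇝* w → weight w ≤ weight v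
⇝*-weight ε        = ≤-refl
⇝*-weight (s ◅ ss) = ≤-trans (⇝*-weight ss) (⇝-weight s)

occupied-weight : ∀ {m} (ws : Vec ℕ (suc m)) → OccupiedButLast ws → 2 ^ m ≤ suc (weight ws)
occupied-weight         (_ ∷ [])         _           = s≤s z≤n
occupied-weight {suc m} (y ∷ ws@(_ ∷ _)) (1≤y , occ) = begin
  2 * 2 ^ m                ≤⟨ *-monoʳ-≤ 2 (occupied-weight ws occ) ⟩
  2 * suc (weight ws)      ≡⟨ *-suc 2 (weight ws) ⟩
  suc (1 + 2 * weight ws)  ≤⟨ s≤s (+-monoˡ-≤ (2 * weight ws) 1≤y) ⟩
  suc (y + 2 * weight ws)  ∎
  where open ≤-Reasoning

-- A virtual pebble on the head of w makes occupied-weight applicable to all of w.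
unreachable : ∀ {m} (v : Vec ℕ (2 + m)) → 2 + weight v < 2 ^ suc m → ¬ Reachable InteriorOccupied v
unreachable {m} v light (x ∷ ws@(_ ∷ _) , v⇝*w , occ) = <⇒≱ light (begin
  2 ^ suc m            ≤⟨ occupied-weight (suc x ∷ ws) (z<s , occ) ⟩
  2 + weight (x ∷ ws)  ≤⟨ +-monoʳ-≤ 2 (⇝*-weight v⇝*w) ⟩
  2 + weight v         ∎)
  where open ≤-Reasoning

endWith : ℕ → ∀ m → Vec ℕ (suc m)
endWith e zero    = e ∷ []
endWith e (suc m) = 0 ∷ endWith e m

weight-endWith : ∀ {e} m → e ≤ 1 → weight (endWith e m) ≡ 0
weight-endWith zero    e≤1 = m≤n⇒m∸n≡0 e≤1
weight-endWith (suc m) e≤1 = trans (weight-∷ 0 (endWith _ m)) (cong (2 *_) (weight-endWith m e≤1))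

sum-endWith : ∀ e m → sum (endWith e m) ≡ e
sum-endWith e zero    = +-identityʳ e
sum-endWith e (suc m) = sum-endWith e m

notAllSolvable : ∀ {m} a e → e ≤ 1 → 2 + a < 2 ^ suc m → ¬ AllSolvable (PathGraph (2 + m)) (a + e)
notAllSolvable {m} a e e≤1 light allSolvable =
  unreachable v (subst (λ w → 2 + w < 2 ^ suc m) (sym weight≡a) light)
    (solvable⇒reachable (λ _ → refl) (allSolvable (lookup v) total≡a+e))
  where
  v = a ∷ endWith e m
  weight≡a : weight v ≡ a
  weight≡a = trans (weight-∷ a (endWith e m))
                   (trans (cong (λ w → a + 2 * w) (weight-endWith m e≤1)) (+-identityʳ a))
  total≡a+e : total (lookup v) ≡ a + e
  total≡a+e = trans (total≡sum {v = v} (λ _ → refl)) (cong (a +_) (sum-endWith e m))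

lowerBound : ∀ m → 1 ≤ m → (s : ℕ) → s < 2 ^ suc m ∸ 1 → ¬ AllSolvable (PathGraph (2 + m)) s
lowerBound (suc k) _ zero    _   =
  notAllSolvable 0 0 z≤n (≤-trans (n≤1+n 3) (*-monoʳ-≤ 2 (2≤2^suc k)))
lowerBound m       _ (suc s) s<t =
  subst (¬_ ∘ AllSolvable (PathGraph (2 + m))) (+-comm s 1)
    (notAllSolvable s 1 ≤-refl
      (subst (_≤ 2 ^ suc m) (+-comm (suc (suc s)) 1)
        (m≤o∸n⇒m+n≤o (suc (suc s)) (m^n>0 2 (suc m)) s<t)))

-- Upper bound

light-budget : ∀ {A c T} → c ≤ 1 → 2 ≤ A → 2 * A ≤ c + T + 1 ⊎ 2 * A ≤ c + 2 → 2 * A ≤ T + 2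
light-budget c≤1 2≤A (inj₂ h) =
  ⊥-elim (<⇒≱ (≤-<-trans h (s≤s (+-monoˡ-≤ 2 c≤1))) (*-monoʳ-≤ 2 2≤A))
light-budget {T = T} c≤1 _ (inj₁ h) =
  ≤-trans h (≤-trans (+-monoˡ-≤ 1 (+-monoˡ-≤ T c≤1)) (≤-reflexive (sym (+-suc T 1))))

spread-budget : ∀ {A b c p S} → c ≤ 1 + p * 2 →
                2 * A ≤ suc (suc c) + (b + S) + 1 ⊎ 2 * A ≤ suc (suc c) + 2 →
                A ≤ p + b + S + 1 ⊎ A ≤ p + b + 2
spread-budget {A} {b} {c} {p} {S} c≤ H with A ≤? p + b + 2
... | yes A≤ = inj₂ A≤
... | no  A≰ with H
...   | inj₂ h = ⊥-elim (<⇒≱ (begin-strict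
          suc (suc c) + 2      ≤⟨ +-monoˡ-≤ 2 (s≤s (s≤s c≤)) ⟩
          3 + p * 2 + 2        <⟨ ≤-trans (≤-reflexive (e₁ p)) (m≤m+n _ (b * 2)) ⟩
          p * 2 + 6 + b * 2    ≡⟨ e₂ p b ⟩
          2 * suc (p + b + 2)  ≤⟨ *-monoʳ-≤ 2 (≰⇒> A≰) ⟩
          2 * A                ∎) h)
  where
  open ≤-Reasoning
  e₁ : ∀ p → suc (3 + p * 2 + 2) ≡ p * 2 + 6
  e₁ = solve-∀
  e₂ : ∀ p b → p * 2 + 6 + b * 2 ≡ 2 * suc (p + b + 2)
  e₂ = solve-∀
...   | inj₁ h = inj₁ (≤-trans (+-cancelʳ-≤ (suc (p + b + 2)) A (p + S + 1) (begin
          A + suc (p + b + 2)          ≤⟨ +-monoʳ-≤ A (≰⇒> A≰) ⟩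
          A + A                        ≡⟨ cong (A +_) (+-identityʳ A) ⟨
          2 * A                        ≤⟨ h ⟩
          suc (suc c) + (b + S) + 1    ≤⟨ +-monoˡ-≤ 1 (+-monoˡ-≤ (b + S) (s≤s (s≤s c≤))) ⟩
          3 + p * 2 + (b + S) + 1      ≡⟨ e p b S ⟩
          p + S + 1 + suc (p + b + 2)  ∎)) (+-monoˡ-≤ 1 (+-monoˡ-≤ S (m≤m+n p b))))
  where
  open ≤-Reasoning
  e : ∀ p b S → 3 + p * 2 + (b + S) + 1 ≡ p + S + 1 + suc (p + b + 2)
  e = solve-∀

reserve-budget : ∀ {B k e S} → 1 ≤ k → 2 ≤ B → suc k * B ≤ k + e + S + 2 → B ≤ e + S + 1
reserve-budget {B} {k} {e} {S} 1≤k 2≤B h = +-cancelʳ-≤ (k + 1) B (e + S + 1) (begin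
  B + (k + 1)          ≤⟨ +-monoʳ-≤ B (begin
                            k + 1  ≤⟨ +-monoʳ-≤ k 1≤k ⟩
                            k + k  ≡⟨ cong (k +_) (+-identityʳ k) ⟨
                            2 * k  ≤⟨ *-monoˡ-≤ k 2≤B ⟩
                            B * k  ≡⟨ *-comm B k ⟩
                            k * B  ∎) ⟩
  B + k * B            ≤⟨ h ⟩
  k + e + S + 2        ≡⟨ reorder k e S ⟩
  e + S + 1 + (k + 1)  ∎)
  where
  open ≤-Reasoning
  reorder : ∀ k e S → k + e + S + 2 ≡ e + S + 1 + (k + 1)
  reorder = solve-∀

deficit-budget : ∀ {P c j T} → 1 ≤ P → suc (suc (c + j)) * (2 * P) ≤ c + T + 2 →
                 suc (1 + suc j * 2) * P ≤ T + 2
deficit-budget {P} {c} {j} {T} 1≤P h = +-cancelˡ-≤ c _ _ (begin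
  c + suc (1 + suc j * 2) * P            ≡⟨ +-comm c _ ⟩
  suc (1 + suc j * 2) * P + c            ≤⟨ +-monoʳ-≤ _ c≤c*2P ⟩
  suc (1 + suc j * 2) * P + c * (2 * P)  ≡⟨ e P c j ⟩
  suc (suc (c + j)) * (2 * P)            ≤⟨ h ⟩
  c + T + 2                              ≡⟨ +-assoc c T 2 ⟩
  c + (T + 2)                            ∎)
  where
  open ≤-Reasoning
  c≤c*2P : c ≤ c * (2 * P)
  c≤c*2P = ≤-trans (≤-reflexive (sym (*-identityʳ c))) (*-monoʳ-≤ c (≤-trans 1≤P (m≤m+n P _)))
  e : ∀ P c j → suc (1 + suc j * 2) * P + c * (2 * P) ≡ suc (suc (c + j)) * (2 * P)
  e = solve-∀

deficit-budget₀ : ∀ {c j b} → suc (suc (c + j)) * 2 ≤ c + (b + 0) + 2 → suc j * 2 ≤ b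
deficit-budget₀ {c} {j} {b} h = +-cancelʳ-≤ (c + 2) _ b (begin
  suc j * 2 + (c + 2)      ≤⟨ m≤m+n _ c ⟩
  suc j * 2 + (c + 2) + c  ≡⟨ e₁ c j ⟩
  suc (suc (c + j)) * 2    ≤⟨ h ⟩
  c + (b + 0) + 2          ≡⟨ e₂ c b ⟩
  b + (c + 2)              ∎)
  where
  open ≤-Reasoning
  e₁ : ∀ c j → suc j * 2 + (c + 2) + c ≡ suc (suc (c + j)) * 2
  e₁ = solve-∀
  e₂ : ∀ c b → c + (b + 0) + 2 ≡ b + (c + 2)
  e₂ = solve-∀

half-≤ : ∀ c → c ≤ 1 + c / 2 * 2
half-≤ c = begin
  c                  ≡⟨ m≡m%n+[m/n]*n c 2 ⟩
  c % 2 + c / 2 * 2  ≤⟨ +-monoˡ-≤ (c / 2 * 2) (≤-pred (m%n<n c 2)) ⟩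
  1 + c / 2 * 2      ∎
  where open ≤-Reasoning

Gathered : ∀ {m} → ℕ → Vec ℕ (2 + m) → Set
Gathered k (x ∷ ws) = k ≤ x × OccupiedButLast ws

-- The second alternative is what remains of the budget after the head, holding almost all
-- pebbles, has been halved onto its neighbour.
spread : ∀ {m} (v : Vec ℕ (2 + m)) → 2 ^ suc m ≤ sum v + 1 ⊎ 2 ^ suc m ≤ head v + 2 →
         Reachable InteriorOccupied v
gather : ∀ {m} k (v : Vec ℕ (2 + m)) → 1 ≤ k → suc k * 2 ^ suc m ≤ sum v + 2 →
         Reachable (Gathered k) v

spreadLight : ∀ {m c} (cs : Vec ℕ (2 + m)) → c ≤ 1 →
              2 ^ suc (suc m) ≤ c + sum cs + 1 ⊎ 2 ^ suc (suc m) ≤ c + 2 →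
              Reachable InteriorOccupied (c ∷ cs)
spreadLight {m} cs c≤1 H
  with h ∷ ts , r , 1≤h , occ ← gather 1 cs ≤-refl (light-budget c≤1 (2≤2^suc m) H) =
  _ , there* r , occupied-∷ ts 1≤h occ

spread {zero}  v@(_ ∷ _ ∷ []) _ = v , ε , tt
spread {suc m} (0 ∷ cs)       H = spreadLight cs z≤n H
spread {suc m} (1 ∷ cs)       H = spreadLight cs ≤-refl H
spread {suc m} (suc (suc c) ∷ b ∷ rest) H
  with h ∷ ts , r , occ ← spread (c / 2 + b ∷ rest)
                             (spread-budget {b = b} {p = c / 2} {S = sum rest} (half-≤ c) H) =
  _ , pushʳ (suc (c / 2)) (s≤s (s≤s (m/n*n≤m c 2))) ◅◅ there* (⇝*-+head 1 r) ,
  occupied-∷ ts z<s occ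

gatherSurplus : ∀ {m} k e (cs : Vec ℕ (suc m)) → 1 ≤ k →
                suc k * 2 ^ suc m ≤ sum (k + e ∷ cs) + 2 →
                Reachable (Gathered k) (k + e ∷ cs)
gatherSurplus {m} k e cs 1≤k H
  with h ∷ ts , r , occ ← spread (e ∷ cs)
                             (inj₁ (reserve-budget {e = e} {S = sum cs} 1≤k (2≤2^suc m) H)) =
  _ , ⇝*-+head k r , m≤m+n k h , occ

gatherDeficit : ∀ {m} c j (cs : Vec ℕ (suc m)) →
                suc (suc (c + j)) * 2 ^ suc m ≤ sum (c ∷ cs) + 2 →
                Reachable (Gathered (suc (c + j))) (c ∷ cs)
gatherDeficit {zero} c j (b ∷ []) H =
  _ , pushˡ (suc j) (deficit-budget₀ {c} {j} H) , s≤s (≤-reflexive (+-comm c j)) , tt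
gatherDeficit {suc m} c j cs H
  with h ∷ ts , r , k≤h , occ ← gather (1 + suc j * 2) cs z<s (deficit-budget (m^n>0 2 (suc m)) H) =
  _ , there* r ◅◅ pushˡ (suc j) (m+n≤o⇒n≤o 1 k≤h) ,
  s≤s (≤-reflexive (+-comm c j)) , occupied-∷ ts (m+n≤o⇒m≤o∸n 1 k≤h) occ

gather k (c ∷ cs) 1≤k H with k ≤? c
... | yes k≤c with e , refl ← m≤n⇒∃[o]m+o≡n k≤c        = gatherSurplus k e cs 1≤k H
... | no  k≰c with j , refl ← m≤n⇒∃[o]m+o≡n (≰⇒> k≰c) = gatherDeficit c j cs H

upperBound : ∀ m → 1 ≤ m → AllSolvable (PathGraph (2 + m)) (2 ^ suc m ∸ 1)
upperBound m 1≤m c total≡ =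
  reachable⇒solvable 1≤m c≗v (spread (tabulate c) (inj₁ (≤-reflexive budget)))
  where
  open ≡-Reasoning
  c≗v : c ≗ lookup (tabulate c)
  c≗v = sym ∘ lookup∘tabulate c
  budget : 2 ^ suc m ≡ sum (tabulate c) + 1
  budget = begin
    2 ^ suc m             ≡⟨ m∸n+n≡m (m^n>0 2 (suc m)) ⟨
    2 ^ suc m ∸ 1 + 1     ≡⟨ cong (_+ 1) (trans (sym total≡) (total≡sum c≗v)) ⟩
    sum (tabulate c) + 1  ∎

mainTheorem1 : (n : ℕ) → 3 ≤ n →
    IsStrongHubCoverPebblingNumber (PathGraph n) (2 ^ (n ∸ 1) ∸ 1)
mainTheorem1 (suc (suc m)) (s≤s (s≤s 1≤m)) = upperBound m 1≤m , lowerBound m 1≤m
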